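{- Let $G$ be a graph and $r$ a positive integer, and suppose no vertex of $G$ has more than one cycle in its $r$-neighborhood. Let $A^{[r]}$ be the $r$-distance matrix ($A^{[r]}_{ij}=1$ iff $d_G(i,j)=r$, else $0$), let $A^{\{r\}}$ be the matrix with $A^{\{r\}}_{ij}$ equal to the number of self-avoiding walks (paths) of length $r$ from $i$ to $j$, and let $B=A^{[r]}-A^{\{r\}}$. Define $v\sim w$ iff there is a cycle contained in the intersection of the $r$-neighborhoods of $v$ and $w$ (this is an equivalence relation under the hypothesis). Then for all $i,j\in V(G)$: (i) $B_{ij}\ne0$ implies $i\sim j$; (ii) $B_{ij}\ne0$ implies there are at least two paths of length at most $r$ from $i$ to $j$; (iii) $|B_{ij}|\le1$; (iv) there are at most two paths of length at most $r$ from $i$ to $j$.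
   Context: The $r$-neighborhood of a vertex $v$ is the subgraph of $G$ induced by the vertices at graph distance at most $r$ from $v$. A path is a self-avoiding walk. -}

module Defs where

open import Data.Nat using (ℕ; zero; suc; _≤_; _≟_)
open import Data.Fin using (Fin)
import Data.Fin as F
open import Data.Bool using (Bool; true; false; _∧_; not; if_then_else_)
open import Data.List using (List; []; _∷_; _++_; [_]; map; concatMap; foldr; upTo; allFin; length)
open import Data.Bool.ListAction using (all; any)
open import Data.List.Membership.Propositional using (_∈_)
open import Data.List.Relation.Unary.All using (All)
open import Data.Integer using (ℤ; +_; _-_)
open import Data.Product using (_×_; _,_; ∃-syntax)
open import Data.Sum using (_⊎_)
open import Relation.Binary.PropositionalEquality using (_≡_)
open import Relation.Nullary.Decidable using (⌊_⌋)
open import Function.Bundles using (_⇔_)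

record Graph (n : ℕ) : Set where
  field
    adj    : Fin n → Fin n → Bool
    sym    : ∀ i j → adj i j ≡ adj j i
    irrefl : ∀ i → adj i i ≡ false
open Graph public

allLists : (n m : ℕ) → List (List (Fin n))
allLists n zero    = [ [] ]
allLists n (suc m) = concatMap (λ v → map (v ∷_) (allLists n m)) (allFin n)

countB : ∀ {A : Set} → (A → Bool) → List A → ℕ
countB p = foldr (λ x acc → if p x then suc acc else acc) 0

pairs : ∀ {A : Set} → List A → List (A × A)
pairs []            = []
pairs (x ∷ [])      = []
pairs (x ∷ y ∷ xs)  = (x , y) ∷ pairs (y ∷ xs)

eqB : ∀ {n} → Fin n → Fin n → Bool
eqB a b = ⌊ a F.≟ b ⌋

distinctB : ∀ {n} → List (Fin n) → Bool
distinctB []       = true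
distinctB (x ∷ xs) = not (any (eqB x) xs) ∧ distinctB xs

lastIs : ∀ {n} → Fin n → List (Fin n) → Bool
lastIs j []           = false
lastIs j (x ∷ [])     = eqB x j
lastIs j (x ∷ y ∷ xs) = lastIs j (y ∷ xs)

isWalkB : ∀ {n} → Graph n → List (Fin n) → Bool
isWalkB G xs = all (λ p → adj G (Data.Product.proj₁ p) (Data.Product.proj₂ p)) (pairs xs)
  where import Data.Product

isWalkFT : ∀ {n} → Graph n → Fin n → Fin n → List (Fin n) → Bool
isWalkFT G i j []       = false
isWalkFT G i j (x ∷ xs) = eqB x i ∧ lastIs j (x ∷ xs) ∧ isWalkB G (x ∷ xs)

isPathFT : ∀ {n} → Graph n → Fin n → Fin n → List (Fin n) → Bool
isPathFT G i j xs = isWalkFT G i j xs ∧ distinctB xs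

-- number of walks / paths of length k (i.e. k edges, k+1 vertices) from i to j
walkCount : ∀ {n} → Graph n → ℕ → Fin n → Fin n → ℕ
walkCount {n} G k i j = countB (isWalkFT G i j) (allLists n (suc k))

pathCount : ∀ {n} → Graph n → ℕ → Fin n → Fin n → ℕ
pathCount {n} G k i j = countB (isPathFT G i j) (allLists n (suc k))

pathsUpTo : ∀ {n} → Graph n → ℕ → Fin n → Fin n → ℕ
pathsUpTo G r i j = foldr (λ k acc → pathCount G k i j Data.Nat.+ acc) 0 (upTo (suc r))
  where import Data.Nat

reachB : ∀ {n} → Graph n → ℕ → Fin n → Fin n → Bool
reachB G k i j = not ⌊ walkCount G k i j ≟ 0 ⌋

distIsB : ∀ {n} → Graph n → ℕ → Fin n → Fin n → Bool
distIsB G r i j = reachB G r i j ∧ all (λ k → not (reachB G k i j)) (upTo r)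

distMat : ∀ {n} → Graph n → ℕ → Fin n → Fin n → ℤ
distMat G r i j = if distIsB G r i j then + 1 else + 0

pathMat : ∀ {n} → Graph n → ℕ → Fin n → Fin n → ℤ
pathMat G r i j = + pathCount G r i j

Bmat : ∀ {n} → Graph n → ℕ → Fin n → Fin n → ℤ
Bmat G r i j = distMat G r i j - pathMat G r i j

InNbhd : ∀ {n} → Graph n → ℕ → Fin n → Fin n → Set
InNbhd G r v u = ∃[ k ] (k ≤ r × reachB G k v u ≡ true)

-- A cycle in G, given by a cyclic vertex sequence x ∷ xs (at least 3 distinct
-- vertices, consecutive ones adjacent, last adjacent to first).
closeUp : ∀ {A : Set} → A → List A → List A
closeUp x xs = x ∷ xs ++ [ x ]

record Cycle {n} (G : Graph n) : Set where
  constructor cyc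
  field
    start    : Fin n
    rest     : List (Fin n)
    long     : 2 ≤ length rest
    distinct : distinctB (start ∷ rest) ≡ true
    closed   : isWalkB G (closeUp start rest) ≡ true
open Cycle public

cycleVerts : ∀ {n} {G : Graph n} → Cycle G → List (Fin n)
cycleVerts c = start c ∷ rest c

CycleEdge : ∀ {n} {G : Graph n} → Cycle G → Fin n → Fin n → Set
CycleEdge c a b = ((a , b) ∈ pairs (closeUp (start c) (rest c)))
                ⊎ ((b , a) ∈ pairs (closeUp (start c) (rest c)))

-- Cycles as subgraphs: two cycles are the same iff they have the same edge set.
SameCycle : ∀ {n} {G : Graph n} → Cycle G → Cycle G → Set
SameCycle c d = ∀ a b → CycleEdge c a b ⇔ CycleEdge d a b

CycleInNbhd : ∀ {n} (G : Graph n) → ℕ → Fin n → Cycle G → Set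
CycleInNbhd G r v c = All (InNbhd G r v) (cycleVerts c)

AtMostOneCycle : ∀ {n} → Graph n → ℕ → Fin n → Set
AtMostOneCycle G r v = ∀ (c d : Cycle G) →
  CycleInNbhd G r v c → CycleInNbhd G r v d → SameCycle c d

Related : ∀ {n} → Graph n → ℕ → Fin n → Fin n → Set
Related G r v w = ∃[ c ] (CycleInNbhd G r v c × CycleInNbhd G r w c)

module Submission where

-- Every vertex of a path of length at most r from i to j is at distance at most r from both i and j.
-- Two distinct such paths contain a cycle (follow them until they part, then until they meet again),
-- and three distinct ones contain two different cycles, all inside the r-neighbourhood of i. Hence
-- there are at most two paths of length at most r, which is (iv). If B_ij ≠ 0 then either d(i,j) = r
-- and the number of paths of length r differs from 1, so it is at least 2 because a shortest walk is a
-- path, or d(i,j) ≠ r although a path of length r exists, so a strictly shorter path exists too; either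
-- way there are two distinct paths of length at most r, and their cycle gives (i) and (ii). For (iii),
-- there are at most two paths of length r, and at most one when d(i,j) ≠ r since a shorter path then
-- makes a third one.

open import Defs hiding (sym)
open import Data.Bool using (Bool; true; false; _∧_; not; if_then_else_)
open import Data.Bool.ListAction using (all; any)
open import Data.Bool.Properties using (T-≡; not-injective)
open import Data.Empty using (⊥; ⊥-elim)
open import Data.Fin using (Fin)
import Data.Fin as Fin
open import Data.Integer using (ℤ; +_; _-_; ∣_∣)
open import Data.List
  using (List; []; _∷_; _++_; [_]; length; reverse; map; concatMap; foldr; allFin; upTo; cartesianProductWith; filterᵇ)
open import Data.List.Properties
  using (++-assoc; ∷-injective; unfold-reverse; reverse-++; length-++; length-++-≤ˡ; length-++-≤ʳ; length-++-sucʳ; length-reverse)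
open import Data.List.Membership.Propositional using (_∈_; _∉_)
open import Data.List.Membership.Propositional.Properties
  using (∈-++⁺ˡ; ∈-++⁺ʳ; ∈-++⁻; ∈-∃++; ∈-allFin; ∈-cartesianProductWith⁺; ∈-cartesianProductWith⁻;
         ∈-filter⁺; ∈-filter⁻; ∈-concat⁻′; ∈-map⁻; ∈-concatMap⁺; ∈-upTo⁺; ∈-upTo⁻)
import Data.List.Membership.DecPropositional as DecMembership
open import Data.List.Relation.Unary.Any using (here; there)
import Data.List.Relation.Unary.Any as Any
import Data.List.Relation.Unary.Any.Properties as Anyₚ
open import Data.List.Relation.Unary.All using (All; []; _∷_)
import Data.List.Relation.Unary.All as All
open import Data.List.Relation.Unary.All.Properties using (All¬⇒¬Any; ¬Any⇒All¬)
import Data.List.Relation.Unary.All.Properties as Allₚ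
open import Data.List.Relation.Unary.AllPairs using ([]; _∷_)
import Data.List.Relation.Unary.AllPairs as AllPairs
import Data.List.Relation.Unary.AllPairs.Properties as AllPairsₚ
import Data.List.Relation.Unary.First as First
open import Data.List.Relation.Unary.First.Properties using (toView)
open import Data.List.Relation.Unary.Unique.Propositional using (Unique)
import Data.List.Relation.Unary.Unique.Propositional.Properties as Unique
open import Data.List.Relation.Binary.Disjoint.Propositional using (Disjoint)
open import Data.List.Relation.Binary.Subset.Propositional using (_⊆_)
open import Data.List.Relation.Binary.Subset.Propositional.Properties using (All-resp-⊇; ++⁺; ++⁺ʳ; xs⊆x∷xs)
import Data.List.Relation.Binary.Permutation.Setoid as PermutationSetoid
import Data.List.Relation.Binary.Permutation.Setoid.Properties as PermutationProperties
open import Data.Nat using (ℕ; zero; suc; _+_; _≤_; _<_; s≤s; z≤n; _≤?_; _≟_)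
open import Data.Nat.Properties
  using (≤-refl; ≤-reflexive; ≤-trans; ≤-pred; <-irrefl; suc-injective; +-comm; m≤m+n; m≤n+m; m≤n⇒m≤1+n;
         m≤n⇒m<n∨m≡n; n<1+n; ≰⇒>; ≤∧≢⇒<)
open import Data.Product using (_×_; _,_; ∃; ∃₂; ∃-syntax; Σ-syntax; proj₁; proj₂; map₁)
open import Data.Sum using (_⊎_; inj₁; inj₂)
import Data.Sum as Sum
open import Function using (_∘_)
open import Function.Bundles using (_⇔_; mk⇔; Equivalence)
open import Relation.Binary.PropositionalEquality using (_≡_; _≢_; refl; sym; trans; cong; subst; setoid)
open import Relation.Nullary using (¬_; yes; no)
open import Relation.Nullary.Decidable using (⌊_⌋; T?)
import Relation.Nullary.Decidable as Dec

∧-true⁻ : ∀ {a b} → a ∧ b ≡ true → a ≡ true × b ≡ true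
∧-true⁻ {true} b≡true = refl , b≡true

∧-true⁺ : ∀ {a b} → a ≡ true → b ≡ true → a ∧ b ≡ true
∧-true⁺ refl refl = refl

module _ {A : Set} where

  private module Permutation = PermutationProperties (setoid A)

  Unique-++⁻ : ∀ (xs : List A) {ys} → Unique (xs ++ ys) → Unique xs × Unique ys × Disjoint xs ys
  Unique-++⁻ []       u = [] , u , λ ()
  Unique-++⁻ (x ∷ xs) (x∉ ∷ u) with uxs , uys , xs#ys ← Unique-++⁻ xs u =
    Allₚ.++⁻ˡ xs x∉ ∷ uxs , uys , x∷xs#ys
    where
    x∷xs#ys : Disjoint (x ∷ xs) _
    x∷xs#ys (here refl , v∈ys)  = All.lookup x∉ (∈-++⁺ʳ xs v∈ys) refl
    x∷xs#ys (there v∈xs , v∈ys) = xs#ys (v∈xs , v∈ys)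

  Unique-reverse : ∀ {xs : List A} → Unique xs → Unique (reverse xs)
  Unique-reverse {xs} = Permutation.Unique-resp-↭ (PermutationSetoid.↭-sym (setoid A) (Permutation.↭-reverse xs))

  ∈⇒1≤length : ∀ {x : A} {xs} → x ∈ xs → 1 ≤ length xs
  ∈⇒1≤length {xs = _ ∷ _} _ = s≤s z≤n

  ∈₂⇒2≤length : ∀ {x y : A} {xs} → x ≢ y → x ∈ xs → y ∈ xs → 2 ≤ length xs
  ∈₂⇒2≤length x≢y (here refl) (here refl) = ⊥-elim (x≢y refl)
  ∈₂⇒2≤length x≢y (here refl) (there y∈)  = s≤s (∈⇒1≤length y∈)
  ∈₂⇒2≤length x≢y (there x∈)  (here refl) = s≤s (∈⇒1≤length x∈)
  ∈₂⇒2≤length x≢y (there x∈)  (there y∈)  = m≤n⇒m≤1+n (∈₂⇒2≤length x≢y x∈ y∈)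

  nonempty⇒∈ : ∀ {xs : List A} → 1 ≤ length xs → ∃ (_∈ xs)
  nonempty⇒∈ {x ∷ _} _ = x , here refl

  unique-pair : ∀ {xs : List A} → Unique xs → 2 ≤ length xs →
                ∃₂ λ x y → x ≢ y × x ∈ xs × y ∈ xs
  unique-pair {x ∷ y ∷ _} ((x≢y ∷ _) ∷ _) _ = x , y , x≢y , here refl , there (here refl)
  unique-pair {_ ∷ []}    _ (s≤s ())

  unique-triple : ∀ {xs : List A} → Unique xs → 3 ≤ length xs →
                  ∃[ x ] ∃[ y ] ∃[ z ] (x ≢ y × x ≢ z × y ≢ z × x ∈ xs × y ∈ xs × z ∈ xs)
  unique-triple {x ∷ y ∷ z ∷ _} ((x≢y ∷ x≢z ∷ _) ∷ (y≢z ∷ _) ∷ _) _ =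
    x , y , z , x≢y , x≢z , y≢z , here refl , there (here refl) , there (there (here refl))
  unique-triple {_ ∷ []}     _ (s≤s ())
  unique-triple {_ ∷ _ ∷ []} _ (s≤s (s≤s ()))

  length-<⇒≢ : ∀ {xs ys : List A} → length xs < length ys → xs ≢ ys
  length-<⇒≢ |xs|<|ys| refl = <-irrefl refl |xs|<|ys|

  ∈-closeUp⁻ : ∀ {x u : A} R → u ∈ closeUp x R → u ∈ x ∷ R
  ∈-closeUp⁻ R (here refl) = here refl
  ∈-closeUp⁻ R (there u∈) with ∈-++⁻ R u∈
  ... | inj₁ u∈R         = there u∈R
  ... | inj₂ (here refl) = here refl

  pairs-∈ : ∀ {s t : A} vs → (s , t) ∈ pairs vs → s ∈ vs × t ∈ vs
  pairs-∈ (_ ∷ _ ∷ _)  (here refl) = here refl , there (here refl)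
  pairs-∈ (_ ∷ y ∷ vs) (there st∈) with s∈ , t∈ ← pairs-∈ (y ∷ vs) st∈ = there s∈ , there t∈

  pairs-fst∈init : ∀ vs {s t w : A} → (s , t) ∈ pairs (vs ++ [ w ]) → s ∈ vs
  pairs-fst∈init (_ ∷ [])     (here refl)  = here refl
  pairs-fst∈init (_ ∷ _ ∷ _)  (here refl)  = here refl
  pairs-fst∈init (_ ∷ y ∷ vs) (there st∈) = there (pairs-fst∈init (y ∷ vs) st∈)

  pairs-into-last : ∀ vs {s v w : A} → w ∉ vs ++ [ v ] → (s , w) ∈ pairs (vs ++ v ∷ [ w ]) → s ≡ v
  pairs-into-last []           w∉ (here refl)  = refl
  pairs-into-last (_ ∷ [])     w∉ (here refl)  = ⊥-elim (w∉ (there (here refl)))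
  pairs-into-last (_ ∷ _ ∷ _)  w∉ (here refl)  = ⊥-elim (w∉ (there (here refl)))
  pairs-into-last (_ ∷ [])     w∉ (there sw∈) = pairs-into-last [] (w∉ ∘ there) sw∈
  pairs-into-last (_ ∷ y ∷ vs) w∉ (there sw∈) = pairs-into-last (y ∷ vs) (w∉ ∘ there) sw∈

module _ {A : Set} (f : A → Bool) where

  all≡true⇒ : ∀ {xs x} → all f xs ≡ true → x ∈ xs → f x ≡ true
  all≡true⇒ {x ∷ xs} h (here refl) = proj₁ (∧-true⁻ h)
  all≡true⇒ {y ∷ xs} h (there x∈) = all≡true⇒ (proj₂ (∧-true⁻ {f y} h)) x∈

  all≡false⇒ : ∀ xs → all f xs ≡ false → ∃[ x ] (x ∈ xs × f x ≡ false)
  all≡false⇒ (x ∷ xs) h with f x in fx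
  ... | false = x , here refl , fx
  ... | true with y , y∈ , fy ← all≡false⇒ xs h = y , there y∈ , fy

∈⇒≤foldr-+ : ∀ {A : Set} (f : A → ℕ) {ks k} → k ∈ ks → f k ≤ foldr (λ k acc → f k + acc) 0 ks
∈⇒≤foldr-+ f (here refl)           = m≤m+n _ _
∈⇒≤foldr-+ f {k′ ∷ _} (there k∈) = ≤-trans (∈⇒≤foldr-+ f k∈) (m≤n+m _ (f k′))

-- Counting

module _ {A : Set} (p : A → Bool) where

  countB-++ : ∀ xs ys → countB p (xs ++ ys) ≡ countB p xs + countB p ys
  countB-++ []       ys = refl
  countB-++ (x ∷ xs) ys with p x
  ... | true  = cong suc (countB-++ xs ys)
  ... | false = countB-++ xs ys

  countB-concatMap : ∀ {B : Set} (f : B → List A) ks →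
                     foldr (λ k acc → countB p (f k) + acc) 0 ks ≡ countB p (concatMap f ks)
  countB-concatMap f []       = refl
  countB-concatMap f (k ∷ ks) =
    trans (cong (λ m → countB p (f k) + m) (countB-concatMap f ks)) (sym (countB-++ (f k) (concatMap f ks)))

  countB≡length-filterᵇ : ∀ xs → countB p xs ≡ length (filterᵇ p xs)
  countB≡length-filterᵇ []       = refl
  countB≡length-filterᵇ (x ∷ xs) with p x
  ... | true  = cong suc (countB≡length-filterᵇ xs)
  ... | false = countB≡length-filterᵇ xs

  Witness : List A → A → Set
  Witness xs x = x ∈ xs × p x ≡ true

  ∈-filterᵇ⁺ : ∀ {xs x} → Witness xs x → x ∈ filterᵇ p xs
  ∈-filterᵇ⁺ (x∈ , px) = ∈-filter⁺ (T? ∘ p) x∈ (Equivalence.from T-≡ px)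

  ∈-filterᵇ⁻ : ∀ {xs x} → x ∈ filterᵇ p xs → Witness xs x
  ∈-filterᵇ⁻ x∈ with x∈xs , px ← ∈-filter⁻ (T? ∘ p) x∈ = x∈xs , Equivalence.to T-≡ px

  witness⇒1≤countB : ∀ {xs x} → Witness xs x → 1 ≤ countB p xs
  witness⇒1≤countB {xs} w rewrite countB≡length-filterᵇ xs = ∈⇒1≤length (∈-filterᵇ⁺ w)

  witnesses⇒2≤countB : ∀ {xs x y} → x ≢ y → Witness xs x → Witness xs y → 2 ≤ countB p xs
  witnesses⇒2≤countB {xs} x≢y wx wy rewrite countB≡length-filterᵇ xs =
    ∈₂⇒2≤length x≢y (∈-filterᵇ⁺ wx) (∈-filterᵇ⁺ wy)

  1≤countB⇒witness : ∀ xs → 1 ≤ countB p xs → ∃ (Witness xs)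
  1≤countB⇒witness xs h rewrite countB≡length-filterᵇ xs
    with x , x∈ ← nonempty⇒∈ h = x , ∈-filterᵇ⁻ x∈

  2≤countB⇒witnesses : ∀ {xs} → Unique xs → 2 ≤ countB p xs →
                       ∃₂ λ x y → x ≢ y × Witness xs x × Witness xs y
  2≤countB⇒witnesses {xs} u h rewrite countB≡length-filterᵇ xs
    with x , y , x≢y , x∈ , y∈ ← unique-pair (Unique.filter⁺ (T? ∘ p) u) h =
    x , y , x≢y , ∈-filterᵇ⁻ x∈ , ∈-filterᵇ⁻ y∈

  3≤countB⇒witnesses : ∀ {xs} → Unique xs → 3 ≤ countB p xs →
                       ∃[ x ] ∃[ y ] ∃[ z ] (x ≢ y × x ≢ z × y ≢ z ×
                                              Witness xs x × Witness xs y × Witness xs z)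
  3≤countB⇒witnesses {xs} u h rewrite countB≡length-filterᵇ xs
    with x , y , z , x≢y , x≢z , y≢z , x∈ , y∈ , z∈ ← unique-triple (Unique.filter⁺ (T? ∘ p) u) h =
    x , y , z , x≢y , x≢z , y≢z , ∈-filterᵇ⁻ x∈ , ∈-filterᵇ⁻ y∈ , ∈-filterᵇ⁻ z∈

module _ {n : ℕ} where

  allLists-suc : ∀ m → allLists n (suc m) ≡ cartesianProductWith _∷_ (allFin n) (allLists n m)
  allLists-suc m = go (allFin n)
    where
    go : ∀ vs → concatMap (λ v → map (v ∷_) (allLists n m)) vs ≡ cartesianProductWith _∷_ vs (allLists n m)
    go []       = refl
    go (v ∷ vs) = cong (map (v ∷_) (allLists n m) ++_) (go vs)

  ∈-allLists⁺ : ∀ (xs : List (Fin n)) → xs ∈ allLists n (length xs)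
  ∈-allLists⁺ []       = here refl
  ∈-allLists⁺ (x ∷ xs) rewrite allLists-suc (length xs) =
    ∈-cartesianProductWith⁺ _∷_ (∈-allFin x) (∈-allLists⁺ xs)

  ∈-allLists⁻ : ∀ m {xs : List (Fin n)} → xs ∈ allLists n m → length xs ≡ m
  ∈-allLists⁻ zero    (here refl) = refl
  ∈-allLists⁻ (suc m) xs∈ rewrite allLists-suc m
    with _ , ys , _ , ys∈ , refl ← ∈-cartesianProductWith⁻ _∷_ (allFin n) (allLists n m) xs∈
    = cong suc (∈-allLists⁻ m ys∈)

  allLists-unique : ∀ m → Unique (allLists n m)
  allLists-unique zero    = [] ∷ []
  allLists-unique (suc m) rewrite allLists-suc m =
    Unique.cartesianProductWith⁺ _∷_ ∷-injective (Unique.allFin⁺ n) (allLists-unique m)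

allListsUpTo : ∀ n → ℕ → List (List (Fin n))
allListsUpTo n r = concatMap (λ k → allLists n (suc k)) (upTo (suc r))

module _ {n : ℕ} (r : ℕ) where

  ∈-allListsUpTo⁺ : ∀ (x : Fin n) xs → length xs ≤ r → x ∷ xs ∈ allListsUpTo n r
  ∈-allListsUpTo⁺ x xs |xs|≤r = ∈-concatMap⁺ (λ k → allLists n (suc k))
    (Any.map (λ { refl → ∈-allLists⁺ (x ∷ xs) }) (∈-upTo⁺ (s≤s |xs|≤r)))

  ∈-allListsUpTo⁻ : ∀ {xs : List (Fin n)} → xs ∈ allListsUpTo n r → length xs ≤ suc r
  ∈-allListsUpTo⁻ xs∈
    with ys , xs∈ys , ys∈ ← ∈-concat⁻′ _ xs∈
    with k , k∈ , refl ← ∈-map⁻ (λ k → allLists n (suc k)) ys∈ =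
    subst (_≤ suc r) (sym (∈-allLists⁻ (suc k) xs∈ys)) (∈-upTo⁻ k∈)

  allListsUpTo-unique : Unique (allListsUpTo n r)
  allListsUpTo-unique = Unique.concat⁺
    (Allₚ.map⁺ (All.universal (λ k → allLists-unique (suc k)) (upTo (suc r))))
    (AllPairsₚ.map⁺ (AllPairs.map lengths-differ (Unique.upTo⁺ (suc r))))
    where
    lengths-differ : ∀ {k l} → k ≢ l → Disjoint (allLists n (suc k)) (allLists n (suc l))
    lengths-differ k≢l (xs∈k , xs∈l) =
      k≢l (suc-injective (trans (sym (∈-allLists⁻ _ xs∈k)) (∈-allLists⁻ _ xs∈l)))

-- Walks and paths

module _ {n : ℕ} (G : Graph n) where

  Adj : Fin n → Fin n → Set
  Adj x y = adj G x y ≡ true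

  data Walk : Fin n → Fin n → List (Fin n) → Set where
    ⟨_⟩ : ∀ x → Walk x x [ x ]
    _∷_ : ∀ {x y z vs} → Adj x y → Walk y z vs → Walk x z (x ∷ vs)

  Path : Fin n → Fin n → List (Fin n) → Set
  Path x z vs = Walk x z vs × Unique vs

module _ {n : ℕ} {G : Graph n} where

  Adj-sym : ∀ {x y} → Adj G x y → Adj G y x
  Adj-sym {x} {y} = trans (Graph.sym G y x)

  walk-∷-view : ∀ {x z vs} → Walk G x z vs → ∃[ ws ] vs ≡ x ∷ ws
  walk-∷-view ⟨ x ⟩   = [] , refl
  walk-∷-view (e ∷ w) = _ , refl

  walk-∷ʳ-view : ∀ {x z vs} → Walk G x z vs → ∃[ init ] vs ≡ init ++ [ z ]
  walk-∷ʳ-view ⟨ x ⟩ = [] , refl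
  walk-∷ʳ-view (_∷_ {x = x} e w) with init , refl ← walk-∷ʳ-view w = x ∷ init , refl

  walk-ends : ∀ {x z vs} → Walk G x z vs → x ≢ z → ∃[ mid ] vs ≡ x ∷ mid ++ [ z ]
  walk-ends ⟨ x ⟩   x≢x = ⊥-elim (x≢x refl)
  walk-ends (e ∷ w) _   with mid , refl ← walk-∷ʳ-view w = mid , refl

  walk-last∈ : ∀ {x z vs} → Walk G x z vs → z ∈ vs
  walk-last∈ ⟨ x ⟩   = here refl
  walk-last∈ (e ∷ w) = there (walk-last∈ w)

  walk-snoc : ∀ {x y z vs} → Walk G x y vs → Adj G y z → Walk G x z (vs ++ [ z ])
  walk-snoc ⟨ x ⟩    e = e ∷ ⟨ _ ⟩
  walk-snoc (e′ ∷ w) e = e′ ∷ walk-snoc w e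

  walk-split : ∀ us {x y z ws} → Walk G x z (us ++ y ∷ ws) →
               Walk G x y (us ++ [ y ]) × Walk G y z (y ∷ ws)
  walk-split []           ⟨ x ⟩   = ⟨ x ⟩ , ⟨ x ⟩
  walk-split []           (e ∷ w) = ⟨ _ ⟩ , e ∷ w
  walk-split (_ ∷ [])     (e ∷ w) = map₁ (e ∷_) (walk-split [] w)
  walk-split (_ ∷ _ ∷ us) (e ∷ w) = map₁ (e ∷_) (walk-split (_ ∷ us) w)

  walk-join : ∀ us {x y z ws} → Walk G x y (us ++ [ y ]) → Walk G y z (y ∷ ws) →
              Walk G x z (us ++ y ∷ ws)
  walk-join []           ⟨ x ⟩   w₂ = w₂
  walk-join (_ ∷ [])     (e ∷ w) w₂ = e ∷ walk-join [] w w₂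
  walk-join (_ ∷ _ ∷ us) (e ∷ w) w₂ = e ∷ walk-join (_ ∷ us) w w₂

  walk-reverse : ∀ {x z vs} → Walk G x z vs → Walk G z x (reverse vs)
  walk-reverse ⟨ x ⟩ = ⟨ x ⟩
  walk-reverse (_∷_ {x = x} {vs = vs} e w) =
    subst (Walk G _ x) (sym (unfold-reverse x vs)) (walk-snoc (walk-reverse w) (Adj-sym e))

  open DecMembership (Fin._≟_ {n}) using (_∈?_)

  walk⇒path : ∀ {x z vs} → Walk G x z vs → ∃[ ws ] (Path G x z ws × length ws ≤ length vs)
  walk⇒path ⟨ x ⟩ = [ x ] , (⟨ x ⟩ , [] ∷ []) , ≤-refl
  walk⇒path (_∷_ {x = x} e w) with walk⇒path w
  ... | ws , (w′ , u) , ws≤vs with x ∈? ws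
  ... | no x∉ws = x ∷ ws , (e ∷ w′ , ¬Any⇒All¬ ws x∉ws ∷ u) , s≤s ws≤vs
  ... | yes x∈ws with us , ts , refl ← ∈-∃++ x∈ws =
    x ∷ ts , (proj₂ (walk-split us w′) , proj₁ (proj₂ (Unique-++⁻ us u))) ,
    m≤n⇒m≤1+n (≤-trans (length-++-≤ʳ (x ∷ ts) {us}) ws≤vs)

module _ {n : ℕ} where

  eqB⇒≡ : ∀ {a b : Fin n} → eqB a b ≡ true → a ≡ b
  eqB⇒≡ {a} {b} eq with a Fin.≟ b
  ... | yes a≡b = a≡b

  eqB-refl : ∀ (a : Fin n) → eqB a a ≡ true
  eqB-refl a with a Fin.≟ a
  ... | yes _  = refl
  ... | no a≢a = ⊥-elim (a≢a refl)

  not-any-eqB⇔All≢ : ∀ x (xs : List (Fin n)) → not (any (eqB x) xs) ≡ true ⇔ All (x ≢_) xs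
  not-any-eqB⇔All≢ x []       = mk⇔ (λ _ → []) (λ _ → refl)
  not-any-eqB⇔All≢ x (y ∷ xs) with x Fin.≟ y
  ... | yes refl = mk⇔ (λ ()) (λ { (x≢x ∷ _) → ⊥-elim (x≢x refl) })
  ... | no x≢y   = mk⇔ (λ h → x≢y ∷ to h) (λ { (_ ∷ h) → from h })
    where open Equivalence (not-any-eqB⇔All≢ x xs)

  distinctB⇔Unique : ∀ (xs : List (Fin n)) → distinctB xs ≡ true ⇔ Unique xs
  distinctB⇔Unique []       = mk⇔ (λ _ → []) (λ _ → refl)
  distinctB⇔Unique (x ∷ xs) = mk⇔
    (λ h → let h₁ , h₂ = ∧-true⁻ h in to (not-any-eqB⇔All≢ x xs) h₁ ∷ to (distinctB⇔Unique xs) h₂)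
    (λ { (x∉ ∷ u) → ∧-true⁺ (from (not-any-eqB⇔All≢ x xs) x∉) (from (distinctB⇔Unique xs) u) })
    where open Equivalence

not⌊≟0⌋⇔1≤ : ∀ m → not ⌊ m ≟ 0 ⌋ ≡ true ⇔ 1 ≤ m
not⌊≟0⌋⇔1≤ zero    = mk⇔ (λ ()) (λ ())
not⌊≟0⌋⇔1≤ (suc m) = mk⇔ (λ _ → s≤s z≤n) (λ _ → refl)

module _ {n : ℕ} {G : Graph n} where

  open Equivalence

  Walk⇒isWalkB : ∀ {x z vs} → Walk G x z vs → isWalkB G vs ≡ true
  Walk⇒isWalkB ⟨ x ⟩           = refl
  Walk⇒isWalkB (e ∷ ⟨ y ⟩)     = ∧-true⁺ e refl
  Walk⇒isWalkB (e ∷ w@(_ ∷ _)) = ∧-true⁺ e (Walk⇒isWalkB w)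

  Walk⇒lastIs : ∀ {x z vs} → Walk G x z vs → lastIs z vs ≡ true
  Walk⇒lastIs ⟨ x ⟩           = eqB-refl x
  Walk⇒lastIs (e ∷ ⟨ y ⟩)     = eqB-refl y
  Walk⇒lastIs (e ∷ w@(_ ∷ _)) = Walk⇒lastIs w

  isWalkB∧lastIs⇒Walk : ∀ {z} x xs → isWalkB G (x ∷ xs) ≡ true → lastIs z (x ∷ xs) ≡ true →
                         Walk G x z (x ∷ xs)
  isWalkB∧lastIs⇒Walk x []       _ x≡z with refl ← eqB⇒≡ x≡z = ⟨ x ⟩
  isWalkB∧lastIs⇒Walk x (y ∷ xs) w l with xy , w′ ← ∧-true⁻ w = xy ∷ isWalkB∧lastIs⇒Walk y xs w′ l

  isWalkFT⇔Walk : ∀ i j vs → isWalkFT G i j vs ≡ true ⇔ Walk G i j vs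
  isWalkFT⇔Walk i j vs = mk⇔ (to′ vs) from′
    where
    to′ : ∀ vs → isWalkFT G i j vs ≡ true → Walk G i j vs
    to′ (x ∷ xs) h
      with x≡i , h′ ← ∧-true⁻ {eqB x i} h
      with refl ← eqB⇒≡ x≡i
      with l , w ← ∧-true⁻ {lastIs j (x ∷ xs)} h′ = isWalkB∧lastIs⇒Walk x xs w l
    from′ : ∀ {vs} → Walk G i j vs → isWalkFT G i j vs ≡ true
    from′ w with _ , refl ← walk-∷-view w =
      ∧-true⁺ (eqB-refl i) (∧-true⁺ (Walk⇒lastIs w) (Walk⇒isWalkB w))

  isPathFT⇔Path : ∀ i j vs → isPathFT G i j vs ≡ true ⇔ Path G i j vs
  isPathFT⇔Path i j vs = mk⇔
    (λ h → let w , u = ∧-true⁻ h in to (isWalkFT⇔Walk i j vs) w , to (distinctB⇔Unique vs) u)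
    (λ (w , u) → ∧-true⁺ (from (isWalkFT⇔Walk i j vs) w) (from (distinctB⇔Unique vs) u))

  reachB⇔walk : ∀ k i j → reachB G k i j ≡ true ⇔ (∃[ vs ] (Walk G i j vs × length vs ≡ suc k))
  reachB⇔walk k i j = mk⇔ to′ from′
    where
    to′ : reachB G k i j ≡ true → ∃[ vs ] (Walk G i j vs × length vs ≡ suc k)
    to′ h with vs , vs∈ , isWalk ← 1≤countB⇒witness (isWalkFT G i j) _ (to (not⌊≟0⌋⇔1≤ _) h) =
      vs , to (isWalkFT⇔Walk i j vs) isWalk , ∈-allLists⁻ (suc k) vs∈
    from′ : ∃[ vs ] (Walk G i j vs × length vs ≡ suc k) → reachB G k i j ≡ true
    from′ (vs , w , |vs|≡1+k) = from (not⌊≟0⌋⇔1≤ _) (witness⇒1≤countB (isWalkFT G i j)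
      (subst (vs ∈_) (cong (allLists n) |vs|≡1+k) (∈-allLists⁺ vs) , from (isWalkFT⇔Walk i j vs) w))

  distIsB-true⁻ : ∀ r i j → distIsB G r i j ≡ true →
                  reachB G r i j ≡ true × (∀ {k} → k < r → reachB G k i j ≡ false)
  distIsB-true⁻ r i j d with reach-r , none-shorter ← ∧-true⁻ {reachB G r i j} d =
    reach-r , λ k<r → not-injective (all≡true⇒ (λ k → not (reachB G k i j)) none-shorter (∈-upTo⁺ k<r))

  distIsB-false⁻ : ∀ r i j → distIsB G r i j ≡ false → reachB G r i j ≡ true →
                   ∃[ k ] (k < r × reachB G k i j ≡ true)
  distIsB-false⁻ r i j d reach-r rewrite reach-r
    with k , k∈ , reach-k ← all≡false⇒ (λ k → not (reachB G k i j)) (upTo r) d =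
    k , ∈-upTo⁻ k∈ , not-injective reach-k

  distIsB⇒path : ∀ r i j → distIsB G r i j ≡ true → ∃[ vs ] (Path G i j vs × length vs ≡ suc r)
  distIsB⇒path r i j d
    with reach-r , none-shorter ← distIsB-true⁻ r i j d
    with vs , w , |vs|≡1+r ← to (reachB⇔walk r i j) reach-r
    with ws , p@(w′ , _) , ws≤vs ← walk⇒path w
    with ws′ , refl ← walk-∷-view w′
    with m≤n⇒m<n∨m≡n (≤-pred (≤-trans ws≤vs (≤-reflexive |vs|≡1+r)))
  ... | inj₂ ws′≡r = ws , p , cong suc ws′≡r
  ... | inj₁ ws′<r
    with () ← trans (sym (from (reachB⇔walk _ i j) (ws , w′ , refl))) (none-shorter ws′<r)

  ¬distIsB⇒shorter-path : ∀ r i j {vs} → distIsB G r i j ≡ false → Path G i j vs → length vs ≡ suc r →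
                           ∃[ ws ] (Path G i j ws × length ws ≤ r)
  ¬distIsB⇒shorter-path r i j ¬dist (w , _) |vs|≡1+r
    with k , k<r , reach-k ← distIsB-false⁻ r i j ¬dist (from (reachB⇔walk r i j) (_ , w , |vs|≡1+r))
    with us , w′ , |us|≡1+k ← to (reachB⇔walk k i j) reach-k
    with ws , p , ws≤us ← walk⇒path w′ =
    ws , p , ≤-trans ws≤us (≤-trans (≤-reflexive |us|≡1+k) k<r)

  walk⊆nbhd : ∀ {r x z vs} → Walk G x z vs → length vs ≤ suc r → ∀ {u} → u ∈ vs → InNbhd G r x u
  walk⊆nbhd {r} w |vs|≤1+r {u} u∈ with us , ws , refl ← ∈-∃++ u∈ =
    length us , |us|≤r ,
    from (reachB⇔walk _ _ _) (us ++ [ u ] , proj₁ (walk-split us w) , trans (length-++ us) (+-comm _ 1))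
    where
    |us|≤r : length us ≤ r
    |us|≤r = ≤-trans (length-++-≤ˡ us)
               (≤-pred (≤-trans (≤-reflexive (sym (length-++-sucʳ us u ws))) |vs|≤1+r))

  walk⊆nbhd-end : ∀ {r x z vs} → Walk G x z vs → length vs ≤ suc r → ∀ {u} → u ∈ vs → InNbhd G r z u
  walk⊆nbhd-end {vs = vs} w |vs|≤1+r u∈ =
    walk⊆nbhd (walk-reverse w) (≤-trans (≤-reflexive (length-reverse vs)) |vs|≤1+r) (Anyₚ.reverse⁺ u∈)

-- Cycles in unions of paths

module _ {n : ℕ} {G : Graph n} where

  open Equivalence
  open DecMembership (Fin._≟_ {n}) using (_∈?_)

  start∉rest : ∀ (c : Cycle G) → All (start c ≢_) (rest c)
  start∉rest c with x∉R ∷ _ ← to (distinctB⇔Unique (cycleVerts c)) (distinct c) = x∉R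

  edge⇒∈cycleVerts : ∀ (c : Cycle G) {s t} → CycleEdge c s t → s ∈ cycleVerts c
  edge⇒∈cycleVerts c (inj₁ st∈) = ∈-closeUp⁻ (rest c) (proj₁ (pairs-∈ _ st∈))
  edge⇒∈cycleVerts c (inj₂ ts∈) = ∈-closeUp⁻ (rest c) (proj₂ (pairs-∈ _ ts∈))

  edges-at-start : ∀ (c : Cycle G) {a mid b} → rest c ≡ a ∷ mid ++ [ b ] →
                   CycleEdge c (start c) a × (∀ {u} → CycleEdge c (start c) u → u ≡ a ⊎ u ≡ b)
  edges-at-start c@(cyc x _ _ _ _) {a} {mid} {b} refl = inj₁ (here refl) , only
    where
    x∉R : x ∉ a ∷ mid ++ [ b ]
    x∉R = All¬⇒¬Any (start∉rest c)
    only : ∀ {u} → CycleEdge c x u → u ≡ a ⊎ u ≡ b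
    only (inj₁ (here refl))  = inj₁ refl
    only (inj₁ (there xu∈)) = ⊥-elim (x∉R (pairs-fst∈init (a ∷ mid ++ [ b ]) xu∈))
    only (inj₂ (here refl))  = ⊥-elim (x∉R (here refl))
    only (inj₂ (there ux∈)) = inj₂ (pairs-into-last (a ∷ mid) x∉R
      (subst (λ L → (_ , x) ∈ pairs (a ∷ L)) (++-assoc mid [ b ] [ x ]) ux∈))

  -- The cycle leaves x towards a, follows ps up to its first vertex y on qs, and returns
  -- to x along qs backwards.
  fork⇒cycle : ∀ {x a b z ps qs} → Adj G x a → Walk G a z ps → Adj G x b → Walk G b z qs →
               Unique (x ∷ ps) → Unique (x ∷ qs) → a ≢ b →
               Σ[ c ∈ Cycle G ] (CycleEdge c x a × (∀ {u} → CycleEdge c x u → u ≡ a ⊎ u ≡ b) ×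
                                 cycleVerts c ⊆ x ∷ ps ++ qs)
  fork⇒cycle {x} {a} {b} {ps = ps} {qs} xa wa xb wb (x∉ps ∷ ups) (x∉qs ∷ uqs) a≢b
    with First.first (λ u → Sum.swap (Dec.toSum (u ∈? qs))) ps
  ... | inj₂ ps∉qs = ⊥-elim (All.lookup ps∉qs (walk-last∈ wa) (walk-last∈ wb))
  ... | inj₁ ps∩qs with toView ps∩qs
  ... | First._++_∷_ {Pin} {y} Pin∉qs y∈qs _ with Qpre , _ , refl ← ∈-∃++ y∈qs =
    c , proj₁ (edges-at-start c R≡) , proj₂ (edges-at-start c R≡) , c⊆
    where
    R : List (Fin n)
    R = Pin ++ y ∷ reverse Qpre

    wR : Walk G a b R
    wR = walk-join Pin (proj₁ (walk-split Pin wa))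
           (subst (Walk G y b) (reverse-++ Qpre [ y ]) (walk-reverse (proj₁ (walk-split Qpre wb))))

    mid : List (Fin n)
    mid = proj₁ (walk-ends wR a≢b)

    R≡ : R ≡ a ∷ mid ++ [ b ]
    R≡ = proj₂ (walk-ends wR a≢b)

    R⊆ : R ⊆ ps ++ qs
    R⊆ u∈ with ∈-++⁻ Pin u∈
    ... | inj₁ u∈Pin        = ∈-++⁺ˡ (∈-++⁺ˡ u∈Pin)
    ... | inj₂ (here refl)  = ∈-++⁺ˡ (∈-++⁺ʳ Pin (here refl))
    ... | inj₂ (there u∈rQ) = ∈-++⁺ʳ ps (∈-++⁺ˡ (Anyₚ.reverse⁻ {xs = Qpre} u∈rQ))

    uR : Unique R
    uR with uPin , _ , Pin#ySuf ← Unique-++⁻ Pin ups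
       |    uQpre , _ , Qpre#yQsuf ← Unique-++⁻ Qpre uqs =
      Unique.++⁺ uPin (y∉rQ ∷ Unique-reverse uQpre) Pin#yrQ
      where
      y∉rQ : All (y ≢_) (reverse Qpre)
      y∉rQ = ¬Any⇒All¬ _ (λ y∈rQ → Qpre#yQsuf (Anyₚ.reverse⁻ {xs = Qpre} y∈rQ , here refl))
      Pin#yrQ : Disjoint Pin (y ∷ reverse Qpre)
      Pin#yrQ (u∈Pin , here refl)  = Pin#ySuf (u∈Pin , here refl)
      Pin#yrQ (u∈Pin , there u∈rQ) = All.lookup Pin∉qs u∈Pin (∈-++⁺ˡ (Anyₚ.reverse⁻ {xs = Qpre} u∈rQ))

    c : Cycle G
    c = cyc x R (subst (λ L → 2 ≤ length L) (sym R≡) (s≤s (∈⇒1≤length (∈-++⁺ʳ mid (here refl)))))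
            (from (distinctB⇔Unique (x ∷ R)) (All-resp-⊇ R⊆ (Allₚ.++⁺ x∉ps x∉qs) ∷ uR))
            (Walk⇒isWalkB (xa ∷ walk-snoc wR (Adj-sym {G = G} xb)))

    c⊆ : cycleVerts c ⊆ x ∷ ps ++ qs
    c⊆ (here refl) = here refl
    c⊆ (there u∈R) = there (R⊆ u∈R)

  trivial-path : ∀ {x vs} → Path G x x vs → vs ≡ [ x ]
  trivial-path (⟨ x ⟩ , _)          = refl
  trivial-path (e ∷ w , x∉vs ∷ _) = ⊥-elim (All.lookup x∉vs (walk-last∈ w) refl)

  distinct-paths⇒cycle : ∀ {x z ps qs} → Path G x z ps → Path G x z qs → ps ≢ qs →
                         Σ[ c ∈ Cycle G ] (cycleVerts c ⊆ ps ++ qs)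
  distinct-paths⇒cycle (⟨ _ ⟩ , _) q ps≢qs = ⊥-elim (ps≢qs (sym (trivial-path q)))
  distinct-paths⇒cycle p (⟨ _ ⟩ , _) ps≢qs = ⊥-elim (ps≢qs (trivial-path p))
  distinct-paths⇒cycle (_∷_ {x = x} {y = a} xa wa , ua@(_ ∷ ua′)) (_∷_ {y = b} xb wb , ub@(_ ∷ ub′)) ps≢qs
    with a Fin.≟ b
  ... | yes refl with c , c⊆ ← distinct-paths⇒cycle (wa , ua′) (wb , ub′) (ps≢qs ∘ cong (x ∷_)) =
    c , ++⁺ (xs⊆x∷xs _ x) (xs⊆x∷xs _ x) ∘ c⊆
  ... | no a≢b with c , _ , _ , c⊆ ← fork⇒cycle xa wa xb wb ua ub a≢b =
    c , ++⁺ʳ (x ∷ _) (xs⊆x∷xs _ x) ∘ c⊆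

  TwoCyclesIn : (Fin n → Set) → Set
  TwoCyclesIn P = Σ[ c ∈ Cycle G ] Σ[ d ∈ Cycle G ] (¬ SameCycle c d × All P (cycleVerts c) × All P (cycleVerts d))

  private
    All-join : ∀ {P : Fin n → Set} {x ps qs} → All P (x ∷ ps) → All P (x ∷ qs) → All P (x ∷ ps ++ qs)
    All-join (px ∷ Pps) (_ ∷ Pqs) = px ∷ Allₚ.++⁺ Pps Pqs

  -- The cycle inside the two paths through a avoids x, the other one passes through x.
  shared-step⇒two-cycles : ∀ {P : Fin n → Set} {x a b z ps qs ss} →
    Adj G x a → Walk G a z ps → Walk G a z qs → Adj G x b → Walk G b z ss →
    Unique (x ∷ ps) → Unique (x ∷ qs) → Unique (x ∷ ss) → ps ≢ qs → a ≢ b →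
    All P (x ∷ ps) → All P (x ∷ qs) → All P (x ∷ ss) → TwoCyclesIn P
  shared-step⇒two-cycles {x = x} {a} {ps = ps} xa wps wqs xb wss
                         ups@(x∉ps ∷ ups′) (x∉qs ∷ uqs′) uss ps≢qs a≢b Pps Pqs Pss
    with c , c⊆ ← distinct-paths⇒cycle (wps , ups′) (wqs , uqs′) ps≢qs
       | d , xa∈d , _ , d⊆ ← fork⇒cycle xa wps xb wss ups uss a≢b =
    c , d , c≉d , All-resp-⊇ c⊆ (Allₚ.++⁺ (All.tail Pps) (All.tail Pqs)) , All-resp-⊇ d⊆ (All-join Pps Pss)
    where
    c≉d : ¬ SameCycle c d
    c≉d c≈d with ∈-++⁻ ps (c⊆ (edge⇒∈cycleVerts c (from (c≈d x a) xa∈d)))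
    ... | inj₁ x∈ps = All.lookup x∉ps x∈ps refl
    ... | inj₂ x∈qs = All.lookup x∉qs x∈qs refl

  -- After dropping a common initial segment, either two of the paths share their first step or the
  -- three first steps x a₁, x a₂, x a₃ differ; then the cycles through {a₂, a₁} and {a₁, a₃} differ at x.
  three-paths⇒two-cycles : ∀ {P : Fin n → Set} {x z ps qs ss} →
    Path G x z ps → Path G x z qs → Path G x z ss → ps ≢ qs → ps ≢ ss → qs ≢ ss →
    All P ps → All P qs → All P ss → TwoCyclesIn P
  three-paths⇒two-cycles (⟨ _ ⟩ , _) q _ ps≢qs _ _ _ _ _ = ⊥-elim (ps≢qs (sym (trivial-path q)))
  three-paths⇒two-cycles p (⟨ _ ⟩ , _) _ ps≢qs _ _ _ _ _ = ⊥-elim (ps≢qs (trivial-path p))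
  three-paths⇒two-cycles p _ (⟨ _ ⟩ , _) _ ps≢ss _ _ _ _ = ⊥-elim (ps≢ss (trivial-path p))
  three-paths⇒two-cycles (_∷_ {x = x} {y = a₁} e₁ w₁ , u₁@(_ ∷ u₁′)) (_∷_ {y = a₂} e₂ w₂ , u₂@(_ ∷ u₂′))
                         (_∷_ {y = a₃} e₃ w₃ , u₃@(_ ∷ u₃′)) ps≢qs ps≢ss qs≢ss P₁ P₂ P₃
    with a₁ Fin.≟ a₂ | a₁ Fin.≟ a₃ | a₂ Fin.≟ a₃
  ... | yes refl | yes refl | _ =
    three-paths⇒two-cycles (w₁ , u₁′) (w₂ , u₂′) (w₃ , u₃′)
      (ps≢qs ∘ cong (x ∷_)) (ps≢ss ∘ cong (x ∷_)) (qs≢ss ∘ cong (x ∷_)) (All.tail P₁) (All.tail P₂) (All.tail P₃)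
  ... | yes refl | no a₁≢a₃ | _ =
    shared-step⇒two-cycles e₁ w₁ w₂ e₃ w₃ u₁ u₂ u₃ (ps≢qs ∘ cong (x ∷_)) a₁≢a₃ P₁ P₂ P₃
  ... | no a₁≢a₂ | yes refl | _ =
    shared-step⇒two-cycles e₁ w₁ w₃ e₂ w₂ u₁ u₃ u₂ (ps≢ss ∘ cong (x ∷_)) a₁≢a₂ P₁ P₃ P₂
  ... | no a₁≢a₂ | no _ | yes refl =
    shared-step⇒two-cycles e₂ w₂ w₃ e₁ w₁ u₂ u₃ u₁ (qs≢ss ∘ cong (x ∷_)) (a₁≢a₂ ∘ sym) P₂ P₃ P₁
  ... | no a₁≢a₂ | no a₁≢a₃ | no a₂≢a₃
    with c , xa₂∈c , _ , c⊆ ← fork⇒cycle e₂ w₂ e₁ w₁ u₂ u₁ (a₁≢a₂ ∘ sym)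
       | d , _ , d-only , d⊆ ← fork⇒cycle e₁ w₁ e₃ w₃ u₁ u₃ a₁≢a₃ =
    c , d , c≉d , All-resp-⊇ c⊆ (All-join P₂ P₁) , All-resp-⊇ d⊆ (All-join P₁ P₃)
    where
    c≉d : ¬ SameCycle c d
    c≉d c≈d with d-only (to (c≈d x a₂) xa₂∈c)
    ... | inj₁ a₂≡a₁ = a₁≢a₂ (sym a₂≡a₁)
    ... | inj₂ a₂≡a₃ = a₂≢a₃ a₂≡a₃

-- The matrix B

-- Bmat G r i j unfolds to Bentry (distIsB G r i j) (pathCount G r i j).
Bentry : Bool → ℕ → ℤ
Bentry d p = (if d then + 1 else + 0) - + p

Bentry≢0⇒ : ∀ d p → Bentry d p ≢ + 0 → (d ≡ true × p ≢ 1) ⊎ (d ≡ false × 1 ≤ p)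
Bentry≢0⇒ true  p       B≢0 = inj₁ (refl , λ { refl → B≢0 refl })
Bentry≢0⇒ false zero    B≢0 = ⊥-elim (B≢0 refl)
Bentry≢0⇒ false (suc p) B≢0 = inj₂ (refl , s≤s z≤n)

∣Bentry∣≤1 : ∀ d p → p ≤ 2 → (d ≡ false → p ≤ 1) → ∣ Bentry d p ∣ ≤ 1
∣Bentry∣≤1 true  0                   _                _   = ≤-refl
∣Bentry∣≤1 true  1                   _                _   = z≤n
∣Bentry∣≤1 true  2                   _                _   = ≤-refl
∣Bentry∣≤1 true  (suc (suc (suc _))) (s≤s (s≤s ()))   _
∣Bentry∣≤1 false 0                   _                _   = z≤n
∣Bentry∣≤1 false 1                   _                _   = ≤-refl
∣Bentry∣≤1 false (suc (suc _))       _                p≤1 with s≤s () ← p≤1 refl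

module _ {n : ℕ} (G : Graph n) (r : ℕ) (i j : Fin n) where

  open Equivalence

  ShortPath : List (Fin n) → Set
  ShortPath vs = Path G i j vs × length vs ≤ suc r

  pathsUpTo≡countB : pathsUpTo G r i j ≡ countB (isPathFT G i j) (allListsUpTo n r)
  pathsUpTo≡countB = countB-concatMap (isPathFT G i j) (λ k → allLists n (suc k)) (upTo (suc r))

  pathCount≤pathsUpTo : pathCount G r i j ≤ pathsUpTo G r i j
  pathCount≤pathsUpTo = ∈⇒≤foldr-+ (λ k → pathCount G k i j) (∈-upTo⁺ (n<1+n r))

  path⇒1≤pathCount : ∀ {vs} → Path G i j vs → length vs ≡ suc r → 1 ≤ pathCount G r i j
  path⇒1≤pathCount {vs} p |vs|≡1+r = witness⇒1≤countB (isPathFT G i j)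
    (subst (vs ∈_) (cong (allLists n) |vs|≡1+r) (∈-allLists⁺ vs) , from (isPathFT⇔Path i j vs) p)

  witness⇒path : ∀ {vs} → Witness (isPathFT G i j) (allLists n (suc r)) vs → Path G i j vs × length vs ≡ suc r
  witness⇒path {vs} (vs∈ , isPath) = to (isPathFT⇔Path i j vs) isPath , ∈-allLists⁻ (suc r) vs∈

  witness⇒short-path : ∀ {vs} → Witness (isPathFT G i j) (allListsUpTo n r) vs → ShortPath vs
  witness⇒short-path {vs} (vs∈ , isPath) = to (isPathFT⇔Path i j vs) isPath , ∈-allListsUpTo⁻ r vs∈

  short-path⇒witness : ∀ {vs} → ShortPath vs → Witness (isPathFT G i j) (allListsUpTo n r) vs
  short-path⇒witness {vs} (p@(w , _) , |vs|≤1+r) with ws , refl ← walk-∷-view w =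
    ∈-allListsUpTo⁺ r _ ws (≤-pred |vs|≤1+r) , from (isPathFT⇔Path i j vs) p

  short-paths⇒2≤pathsUpTo : ∀ {xs ys} → xs ≢ ys → ShortPath xs → ShortPath ys → 2 ≤ pathsUpTo G r i j
  short-paths⇒2≤pathsUpTo xs≢ys sx sy rewrite pathsUpTo≡countB =
    witnesses⇒2≤countB (isPathFT G i j) xs≢ys (short-path⇒witness sx) (short-path⇒witness sy)

  short-path⊆nbhd-start : ∀ {vs} → ShortPath vs → All (InNbhd G r i) vs
  short-path⊆nbhd-start ((w , _) , |vs|≤1+r) = All.tabulate (walk⊆nbhd w |vs|≤1+r)

  short-path⊆nbhd-end : ∀ {vs} → ShortPath vs → All (InNbhd G r j) vs
  short-path⊆nbhd-end ((w , _) , |vs|≤1+r) = All.tabulate (walk⊆nbhd-end w |vs|≤1+r)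

  short-paths⇒related : ∀ {xs ys} → xs ≢ ys → ShortPath xs → ShortPath ys → Related G r i j
  short-paths⇒related xs≢ys sx sy with c , c⊆ ← distinct-paths⇒cycle (proj₁ sx) (proj₁ sy) xs≢ys =
    c , All-resp-⊇ c⊆ (Allₚ.++⁺ (short-path⊆nbhd-start sx) (short-path⊆nbhd-start sy))
      , All-resp-⊇ c⊆ (Allₚ.++⁺ (short-path⊆nbhd-end sx) (short-path⊆nbhd-end sy))

  no-three-short-paths : AtMostOneCycle G r i → ∀ {xs ys zs} → xs ≢ ys → xs ≢ zs → ys ≢ zs →
                         ShortPath xs → ShortPath ys → ShortPath zs → ⊥
  no-three-short-paths unicyclic xs≢ys xs≢zs ys≢zs sx sy sz
    with c , d , c≉d , c⊆nbhd , d⊆nbhd ←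
         three-paths⇒two-cycles (proj₁ sx) (proj₁ sy) (proj₁ sz) xs≢ys xs≢zs ys≢zs
           (short-path⊆nbhd-start sx) (short-path⊆nbhd-start sy) (short-path⊆nbhd-start sz) =
    c≉d (unicyclic c d c⊆nbhd d⊆nbhd)

  pathsUpTo≤2 : AtMostOneCycle G r i → pathsUpTo G r i j ≤ 2
  pathsUpTo≤2 unicyclic with pathsUpTo G r i j ≤? 2
  ... | yes ≤2 = ≤2
  ... | no ≰2
    with xs , ys , zs , xs≢ys , xs≢zs , ys≢zs , wx , wy , wz ←
         3≤countB⇒witnesses (isPathFT G i j) (allListsUpTo-unique r) (subst (3 ≤_) pathsUpTo≡countB (≰⇒> ≰2))
    with () ← no-three-short-paths unicyclic xs≢ys xs≢zs ys≢zs
                (witness⇒short-path wx) (witness⇒short-path wy) (witness⇒short-path wz)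

  ¬distIsB⇒pathCount≤1 : AtMostOneCycle G r i → distIsB G r i j ≡ false → pathCount G r i j ≤ 1
  ¬distIsB⇒pathCount≤1 unicyclic ¬dist with pathCount G r i j ≤? 1
  ... | yes ≤1 = ≤1
  ... | no ≰1
    with xs , ys , xs≢ys , wx , wy ← 2≤countB⇒witnesses (isPathFT G i j) (allLists-unique (suc r)) (≰⇒> ≰1)
    with px , |xs|≡1+r ← witness⇒path wx
       | py , |ys|≡1+r ← witness⇒path wy
    with zs , pz , |zs|≤r ← ¬distIsB⇒shorter-path r i j ¬dist px |xs|≡1+r
    with () ← no-three-short-paths unicyclic
                (length-<⇒≢ (subst (length zs <_) (sym |xs|≡1+r) (s≤s |zs|≤r)))
                (length-<⇒≢ (subst (length zs <_) (sym |ys|≡1+r) (s≤s |zs|≤r))) xs≢ys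
                (pz , m≤n⇒m≤1+n |zs|≤r) (px , ≤-reflexive |xs|≡1+r) (py , ≤-reflexive |ys|≡1+r)

  ∣Bmat∣≤1 : AtMostOneCycle G r i → ∣ Bmat G r i j ∣ ≤ 1
  ∣Bmat∣≤1 unicyclic = ∣Bentry∣≤1 (distIsB G r i j) (pathCount G r i j)
    (≤-trans pathCount≤pathsUpTo (pathsUpTo≤2 unicyclic)) (¬distIsB⇒pathCount≤1 unicyclic)

  Bmat≢0⇒short-paths : Bmat G r i j ≢ + 0 → ∃₂ λ xs ys → xs ≢ ys × ShortPath xs × ShortPath ys
  Bmat≢0⇒short-paths B≢0 with Bentry≢0⇒ (distIsB G r i j) (pathCount G r i j) B≢0
  ... | inj₁ (dist , pathCount≢1)
    with vs , p , |vs|≡1+r ← distIsB⇒path r i j dist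
    with xs , ys , xs≢ys , wx , wy ←
         2≤countB⇒witnesses (isPathFT G i j) (allLists-unique (suc r))
           (≤∧≢⇒< (path⇒1≤pathCount p |vs|≡1+r) (pathCount≢1 ∘ sym))
    with px , |xs|≡1+r ← witness⇒path wx
       | py , |ys|≡1+r ← witness⇒path wy =
    xs , ys , xs≢ys , (px , ≤-reflexive |xs|≡1+r) , (py , ≤-reflexive |ys|≡1+r)
  ... | inj₂ (¬dist , 1≤pathCount)
    with xs , wx ← 1≤countB⇒witness (isPathFT G i j) _ 1≤pathCount
    with px , |xs|≡1+r ← witness⇒path wx
    with zs , pz , |zs|≤r ← ¬distIsB⇒shorter-path r i j ¬dist px |xs|≡1+r =
    zs , xs , length-<⇒≢ (subst (length zs <_) (sym |xs|≡1+r) (s≤s |zs|≤r)) ,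
    (pz , m≤n⇒m≤1+n |zs|≤r) , (px , ≤-reflexive |xs|≡1+r)

-- The hypothesis 1 ≤ r is unused: for r = 0 the matrix B vanishes.
proposition1 : ∀ {n} (G : Graph n) (r : ℕ) → 1 ≤ r →
    (∀ v → AtMostOneCycle G r v) →
    ∀ (i j : Fin n) →
      (Bmat G r i j ≢ + 0 → Related G r i j)
      × (Bmat G r i j ≢ + 0 → 2 ≤ pathsUpTo G r i j)
      × (∣ Bmat G r i j ∣ ≤ 1)
      × (pathsUpTo G r i j ≤ 2)
proposition1 G r _ unicyclic i j =
  (λ B≢0 → let _ , _ , xs≢ys , sx , sy = Bmat≢0⇒short-paths G r i j B≢0
           in short-paths⇒related G r i j xs≢ys sx sy) ,
  (λ B≢0 → let _ , _ , xs≢ys , sx , sy = Bmat≢0⇒short-paths G r i j B≢0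
           in short-paths⇒2≤pathsUpTo G r i j xs≢ys sx sy) ,
  ∣Bmat∣≤1 G r i j (unicyclic i) ,
  pathsUpTo≤2 G r i j (unicyclic i)
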